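{- For every integer $k\ge 1$ and every $b\in\{\mathrm{T},\mathrm{F}\}$, $M_{k,\mathrm{F}\cdots b}=M_{k-1,\mathrm{T}\cdots b}$.
   Context: Unordered CNF game: an instance is a pair $(\varphi,X)$ where $\varphi$ is a CNF formula (a set of clauses, each clause a disjunction of literals $x_i$ or $\overline{x}_i$) and $X$ is a finite set of boolean variables containing every variable appearing in $\varphi$ (and possibly more). Two players, T and F, alternate turns; on each turn the player picks a not-yet-assigned variable from $X$ and assigns it the value $0$ or $1$ of their choice. The game ends when all variables of $X$ are assigned; T wins if $\varphi$ is satisfied and F wins otherwise. Which player moves last is determined by who moves first and the parity of $|X|$. A CNF is $k$-uniform if every clause has exactly $k$ literals, on $k$ distinct variables. For $k\ge 0$ and $a,b\in\{\mathrm{T},\mathrm{F}\}$, $M_{k,a\cdots b}$ denotes the minimum number of clauses of $\varphi$ over all instances $(\varphi,X)$ with $\varphi$ $k$-uniform such that F has a winning strategy when player $a$ makes the first move and player $b$ makes the last move. -}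

module Defs where

open import Data.Nat using (ℕ; zero; suc; _≤_; _∸_)
open import Data.Fin using (Fin; _≟_)
open import Data.Bool using (Bool; true; false; if_then_else_)
open import Data.Maybe using (Maybe; just; nothing)
open import Data.Product using (Σ; _×_; _,_; proj₁; ∃)
open import Data.List using (List; length; map)
open import Data.List.Relation.Unary.All using (All)
open import Data.List.Relation.Unary.Any using (Any)
open import Data.List.Relation.Unary.Unique.Propositional using (Unique)
open import Relation.Nullary using (¬_)
open import Relation.Nullary.Decidable using (⌊_⌋)
open import Relation.Binary.PropositionalEquality using (_≡_; _≢_)
open import Function.Bundles using (_⇔_)

data Player : Set where
  T F : Player

other : Player → Player
other T = F
other F = T

-- A literal over the variable set X = Fin n: (i , true) is x_i, (i , false) is ¬x_i.
Literal : ℕ → Set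
Literal n = Fin n × Bool

Clause : ℕ → Set
Clause n = List (Literal n)

CNF : ℕ → Set
CNF n = List (Clause n)

Uniform : ∀ {n} → ℕ → CNF n → Set
Uniform k φ = All (λ c → (length c ≡ k) × Unique (map proj₁ c)) φ

PAssign : ℕ → Set
PAssign n = Fin n → Maybe Bool

empty : ∀ {n} → PAssign n
empty _ = nothing

_[_≔_] : ∀ {n} → PAssign n → Fin n → Bool → PAssign n
(σ [ i ≔ b ]) j = if ⌊ j ≟ i ⌋ then just b else σ j

Full : ∀ {n} → PAssign n → Set
Full σ = ∀ i → σ i ≢ nothing

LitSat : ∀ {n} → PAssign n → Literal n → Set
LitSat σ (i , b) = σ i ≡ just b

Sat : ∀ {n} → PAssign n → CNF n → Set
Sat σ φ = All (λ c → Any (LitSat σ) c) φ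

-- FWins φ p σ : from position σ with player p to move, F has a winning strategy.
data FWins {n : ℕ} (φ : CNF n) : Player → PAssign n → Set where
  end   : ∀ {p σ} → Full σ → ¬ Sat σ φ → FWins φ p σ
  moveF : ∀ {σ} → ¬ Full σ → (i : Fin n) → σ i ≡ nothing → (b : Bool) →
          FWins φ T (σ [ i ≔ b ]) → FWins φ F σ
  moveT : ∀ {σ} → ¬ Full σ →
          (∀ (i : Fin n) → σ i ≡ nothing → ∀ (b : Bool) → FWins φ F (σ [ i ≔ b ])) →
          FWins φ T σ

-- The player making the last of m ≥ 1 moves, when player a moves first.
lastMover : Player → ℕ → Player
lastMover a zero = a
lastMover a (suc zero) = a
lastMover a (suc (suc m)) = lastMover (other a) (suc m)

-- An instance (φ , X) with X = Fin n, φ k-uniform, in which a moves first,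
-- b moves last (so |X| ≥ 1), and F has a winning strategy.
record Instance (k : ℕ) (a b : Player) : Set where
  field
    n       : ℕ
    nonempty : 1 ≤ n
    φ       : CNF n
    uniform : Uniform k φ
    last    : lastMover a n ≡ b
    fwins   : FWins φ a empty

-- m is the minimum number of clauses over all such instances: M_{k,a⋯b} = m.
IsM : ℕ → Player → Player → ℕ → Set
IsM k a b m =
  Σ (Instance k a b) (λ I → length (Instance.φ I) ≡ m) ×
  (∀ (I : Instance k a b) → m ≤ length (Instance.φ I))

-- F's opening move in the (k+1)-uniform game fixes some x_i := c.  Deleting x_i, dropping the
-- clauses it satisfies and one further literal from each other clause yields a k-uniform game
-- with T to move and the same last mover, which F still wins: every position of the small
-- game is a position of the big one with x_i := c inserted, and satisfying the small formula
-- forces satisfying the big one.  Conversely, adding a fresh variable x_0 positively to every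
-- clause of a k-uniform instance and letting F open with x_0 := 0 gives back a (k+1)-uniform
-- instance with F first and the same number of clauses.
module Submission where

open import Defs
open import Data.Nat using (ℕ; suc)
open import Function.Bundles using (_⇔_)

open import Data.Nat using (zero; _≤_; z≤n; s≤s)
open import Data.Nat.Properties using (≤-refl; ≤-reflexive; ≤-trans; ≤-antisym; ≤-pred; m≤n⇒m≤1+n; m≤n⇒m⊓n≡m)
open import Data.Fin using (Fin; zero; suc; _≟_; punchIn; punchOut)
open import Data.Fin.Properties using (punchInᵢ≢i; punchIn-injective; punchIn-punchOut; punchOut-injective)
open import Data.Bool using (Bool; false; not)
open import Data.Bool.Properties using (not-¬)
import Data.Bool as Bool
open import Data.Maybe using (just; nothing)
open import Data.Maybe.Properties using (just-injective)
open import Data.Product using (Σ; ∃; _×_; _,_; proj₁; proj₂; map₁; map₂)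
open import Data.Product.Properties using (≡-dec)
open import Data.List using (List; []; _∷_; length; map; take)
open import Data.List.Properties using (map-∘; length-map; length-take; take-map; take++drop≡id)
open import Data.List.Relation.Unary.All using (All; []; _∷_)
import Data.List.Relation.Unary.All as All
import Data.List.Relation.Unary.All.Properties as All
open import Data.List.Relation.Unary.Any using (Any; here; there)
import Data.List.Relation.Unary.Any as Any
import Data.List.Relation.Unary.Any.Properties as Any
open import Data.List.Relation.Unary.AllPairs using ([]; _∷_)
open import Data.List.Relation.Unary.Unique.Propositional using (Unique)
import Data.List.Relation.Unary.Unique.Propositional.Properties as Unique
open import Data.Empty using (⊥-elim)
open import Function using (_∘_)
open import Relation.Nullary using (¬_; yes; no)
open import Relation.Binary.PropositionalEquality
open import Function.Bundles using (mk⇔)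

vars : ∀ {n} → Clause n → List (Fin n)
vars = map proj₁

size : ∀ {k a b} → Instance k a b → ℕ
size I = length (Instance.φ I)

update-≡ : ∀ {n} (σ : PAssign n) (i : Fin n) b → (σ [ i ≔ b ]) i ≡ just b
update-≡ σ i b with i ≟ i
... | yes _ = refl
... | no i≢i = ⊥-elim (i≢i refl)

update-≢ : ∀ {n} (σ : PAssign n) {i j : Fin n} b → j ≢ i → (σ [ i ≔ b ]) j ≡ σ j
update-≢ σ {i} {j} b j≢i with j ≟ i
... | yes j≡i = ⊥-elim (j≢i j≡i)
... | no _ = refl

record Inserts {n} (i : Fin (suc n)) (c : Bool) (σ : PAssign n) (τ : PAssign (suc n)) : Set where
  field
    pivot : τ i ≡ just c
    agree : ∀ j → τ (punchIn i j) ≡ σ j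

open Inserts

Inserts-empty : ∀ {n} (i : Fin (suc n)) c → Inserts i c empty (empty [ i ≔ c ])
Inserts-empty i c = record
  { pivot = update-≡ empty i c
  ; agree = λ j → update-≢ empty c (punchInᵢ≢i i j)
  }

module _ {n} {i : Fin (suc n)} {c : Bool} {σ : PAssign n} {τ : PAssign (suc n)}
         (ins : Inserts i c σ τ) where

  Inserts-free : ∀ {v} → τ v ≡ nothing → ∃ λ j → v ≡ punchIn i j × σ j ≡ nothing
  Inserts-free {v} τv≡nothing with i ≟ v
  ... | yes refl with trans (sym (pivot ins)) τv≡nothing
  ...   | ()
  Inserts-free {v} τv≡nothing | no i≢v =
    punchOut i≢v , sym (punchIn-punchOut i≢v) ,
    trans (sym (agree ins (punchOut i≢v))) (trans (cong τ (punchIn-punchOut i≢v)) τv≡nothing)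

  Inserts-full : Full σ → Full τ
  Inserts-full full v τv≡nothing = full _ (proj₂ (proj₂ (Inserts-free τv≡nothing)))

  Inserts-full⁻ : Full τ → Full σ
  Inserts-full⁻ full j σj≡nothing = full (punchIn i j) (trans (agree ins j) σj≡nothing)

  Inserts-update : ∀ j b → Inserts i c (σ [ j ≔ b ]) (τ [ punchIn i j ≔ b ])
  Inserts-update j b = record
    { pivot = trans (update-≢ τ b (punchInᵢ≢i i j ∘ sym)) (pivot ins)
    ; agree = agree′
    }
    where
    agree′ : ∀ j′ → (τ [ punchIn i j ≔ b ]) (punchIn i j′) ≡ (σ [ j ≔ b ]) j′
    agree′ j′ with j′ ≟ j
    ... | yes refl = update-≡ τ (punchIn i j) b
    ... | no j′≢j = trans (update-≢ τ b (j′≢j ∘ punchIn-injective i j′ j)) (agree ins j′)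

module _ {n} {i : Fin (suc n)} {c : Bool} {φ : CNF n} {ψ : CNF (suc n)} where

  FWins-insert : (∀ {σ τ} → Inserts i c σ τ → Sat τ ψ → Sat σ φ) →
                 ∀ {p σ τ} → Inserts i c σ τ → FWins φ p σ → FWins ψ p τ
  FWins-insert sat ins (end full unsat) = end (Inserts-full ins full) (unsat ∘ sat ins)
  FWins-insert sat ins (moveF notFull j σj≡nothing b win) =
    moveF (notFull ∘ Inserts-full⁻ ins) (punchIn i j) (trans (agree ins j) σj≡nothing) b
          (FWins-insert sat (Inserts-update ins j b) win)
  FWins-insert sat {τ = τ} ins (moveT notFull wins) = moveT (notFull ∘ Inserts-full⁻ ins) reply
    where
    reply : ∀ v → τ v ≡ nothing → ∀ b → FWins ψ F (τ [ v ≔ b ])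
    reply v τv≡nothing b with Inserts-free ins τv≡nothing
    ... | j , refl , σj≡nothing = FWins-insert sat (Inserts-update ins j b) (wins j σj≡nothing b)

  FWins-delete : (∀ {σ τ} → Inserts i c σ τ → Sat σ φ → Sat τ ψ) →
                 ∀ {p σ τ} → Inserts i c σ τ → FWins ψ p τ → FWins φ p σ
  FWins-delete sat ins (end full unsat) = end (Inserts-full⁻ ins full) (unsat ∘ sat ins)
  FWins-delete sat ins (moveF notFull v τv≡nothing b win) with Inserts-free ins τv≡nothing
  ... | j , refl , σj≡nothing =
    moveF (notFull ∘ Inserts-full ins) j σj≡nothing b (FWins-delete sat (Inserts-update ins j b) win)
  FWins-delete sat {σ = σ} ins (moveT notFull wins) = moveT (notFull ∘ Inserts-full ins) reply
    where
    reply : ∀ j → σ j ≡ nothing → ∀ b → FWins φ F (σ [ j ≔ b ])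
    reply j σj≡nothing b =
      FWins-delete sat (Inserts-update ins j b) (wins (punchIn i j) (trans (agree ins j) σj≡nothing) b)

module Extend {n} (i : Fin (suc n)) (c : Bool) where

  extendClause : Clause n → Clause (suc n)
  extendClause cl = (i , not c) ∷ map (map₁ (punchIn i)) cl

  extend : CNF n → CNF (suc n)
  extend = map extendClause

  vars-extendClause : ∀ cl → vars (extendClause cl) ≡ i ∷ map (punchIn i) (vars cl)
  vars-extendClause cl = cong (i ∷_) (trans (sym (map-∘ cl)) (map-∘ cl))

  extend-uniform : ∀ {k φ} → Uniform k φ → Uniform (suc k) (extend φ)
  extend-uniform = All.map⁺ ∘ All.map extendClause-uniform
    where
    extendClause-uniform : ∀ {k cl} → length cl ≡ k × Unique (vars cl) →
                           length (extendClause cl) ≡ suc k × Unique (vars (extendClause cl))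
    extendClause-uniform {cl = cl} (len , distinct) =
      cong suc (trans (length-map _ cl) len) ,
      subst Unique (sym (vars-extendClause cl))
        (All.map⁺ (All.universal (λ j → punchInᵢ≢i i j ∘ sym) (vars cl))
         ∷ Unique.map⁺ (punchIn-injective i _ _) distinct)

  extend-sat : ∀ {φ σ τ} → Inserts i c σ τ → Sat τ (extend φ) → Sat σ φ
  extend-sat {σ = σ} {τ} ins = All.map extendClause-sat ∘ All.map⁻
    where
    extendClause-sat : ∀ {cl} → Any (LitSat τ) (extendClause cl) → Any (LitSat σ) cl
    extendClause-sat (here τi≡¬c) = ⊥-elim (not-¬ refl (just-injective (trans (sym (pivot ins)) τi≡¬c)))
    extendClause-sat (there sat) = Any.map (λ {l} τ≡ → trans (sym (agree ins (proj₁ l))) τ≡) (Any.map⁻ sat)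

Any-take : ∀ {A : Set} {P : A → Set} k {xs : List A} → Any P (take k xs) → Any P xs
Any-take k {xs} = subst (Any _) (take++drop≡id k xs) ∘ Any.++⁺ˡ

module _ {n} (i : Fin (suc n)) where

  removeVar : Clause (suc n) → Clause n
  removeVar [] = []
  removeVar ((v , b) ∷ cl) with i ≟ v
  ... | yes _ = removeVar cl
  ... | no i≢v = (punchOut i≢v , b) ∷ removeVar cl

  length-removeVar-fresh : ∀ cl → All (i ≢_) (vars cl) → length cl ≤ length (removeVar cl)
  length-removeVar-fresh [] [] = z≤n
  length-removeVar-fresh ((v , b) ∷ cl) (i≢v ∷ fresh) with i ≟ v
  ... | yes i≡v = ⊥-elim (i≢v i≡v)
  ... | no _ = s≤s (length-removeVar-fresh cl fresh)

  length-removeVar : ∀ cl → Unique (vars cl) → length cl ≤ suc (length (removeVar cl))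
  length-removeVar [] [] = z≤n
  length-removeVar ((v , b) ∷ cl) (v∉cl ∷ distinct) with i ≟ v
  ... | yes refl = s≤s (length-removeVar-fresh cl v∉cl)
  ... | no _ = s≤s (length-removeVar cl distinct)

  All-removeVar : ∀ {P : Fin (suc n) → Set} {Q : Fin n → Set} →
                  (∀ {v} (i≢v : i ≢ v) → P v → Q (punchOut i≢v)) →
                  ∀ cl → All P (vars cl) → All Q (vars (removeVar cl))
  All-removeVar f [] [] = []
  All-removeVar f ((v , b) ∷ cl) (pv ∷ ps) with i ≟ v
  ... | yes _ = All-removeVar f cl ps
  ... | no i≢v = f i≢v pv ∷ All-removeVar f cl ps

  unique-removeVar : ∀ cl → Unique (vars cl) → Unique (vars (removeVar cl))
  unique-removeVar [] [] = []
  unique-removeVar ((v , b) ∷ cl) (v∉cl ∷ distinct) with i ≟ v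
  ... | yes _ = unique-removeVar cl distinct
  ... | no i≢v =
    All-removeVar (λ i≢w v≢w → v≢w ∘ punchOut-injective i≢v i≢w) cl v∉cl ∷ unique-removeVar cl distinct

  removeVar-sat : ∀ {c σ τ} → Inserts i c σ τ → ∀ cl → Any (LitSat σ) (removeVar cl) → Any (LitSat τ) cl
  removeVar-sat ins ((v , b) ∷ cl) sat with i ≟ v
  removeVar-sat ins ((v , b) ∷ cl) sat | yes _ = there (removeVar-sat ins cl sat)
  removeVar-sat {τ = τ} ins ((v , b) ∷ cl) (here σ≡) | no i≢v =
    here (trans (cong τ (sym (punchIn-punchOut i≢v))) (trans (agree ins _) σ≡))
  removeVar-sat ins ((v , b) ∷ cl) (there sat) | no _ = there (removeVar-sat ins cl sat)

module Restrict {n} (i : Fin (suc n)) (c : Bool) (k : ℕ) where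
  open import Data.List.Membership.DecPropositional (≡-dec (_≟_ {suc n}) Bool._≟_) using (_∈?_)

  -- After removeVar a clause not mentioning x_i still has k + 1 literals; take k drops one,
  -- which only makes the clause harder to satisfy.
  restrict : CNF (suc n) → CNF n
  restrict [] = []
  restrict (cl ∷ ψ) with (i , c) ∈? cl
  ... | yes _ = restrict ψ
  ... | no _ = take k (removeVar i cl) ∷ restrict ψ

  length-restrict : ∀ ψ → length (restrict ψ) ≤ length ψ
  length-restrict [] = z≤n
  length-restrict (cl ∷ ψ) with (i , c) ∈? cl
  ... | yes _ = m≤n⇒m≤1+n (length-restrict ψ)
  ... | no _ = s≤s (length-restrict ψ)

  restrict-uniform : ∀ {ψ} → Uniform (suc k) ψ → Uniform k (restrict ψ)
  restrict-uniform {[]} [] = []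
  restrict-uniform {cl ∷ ψ} ((len , distinct) ∷ uniform) with (i , c) ∈? cl
  ... | yes _ = restrict-uniform uniform
  ... | no _ =
    (trans (length-take k (removeVar i cl)) (m≤n⇒m⊓n≡m k≤length) ,
     subst Unique (take-map k (removeVar i cl)) (Unique.take⁺ k (unique-removeVar i cl distinct)))
    ∷ restrict-uniform uniform
    where
    k≤length : k ≤ length (removeVar i cl)
    k≤length = ≤-pred (subst (_≤ suc (length (removeVar i cl))) len (length-removeVar i cl distinct))

  restrict-sat : ∀ {ψ σ τ} → Inserts i c σ τ → Sat σ (restrict ψ) → Sat τ ψ
  restrict-sat {[]} ins [] = []
  restrict-sat {cl ∷ ψ} ins sat with (i , c) ∈? cl
  ... | yes ic∈cl = Any.map (λ { refl → pivot ins }) ic∈cl ∷ restrict-sat ins sat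
  restrict-sat {cl ∷ ψ} ins (satCl ∷ sat) | no _ =
    removeVar-sat i ins cl (Any-take k satCl) ∷ restrict-sat ins sat

Reduces : ℕ → Player → Player → ℕ → Player → Player → Set
Reduces k a b k′ a′ b′ = (I : Instance k a b) → Σ (Instance k′ a′ b′) λ J → size J ≤ size I

IsM-transport : ∀ {k a b k′ a′ b′ m} → Reduces k a b k′ a′ b′ → Reduces k′ a′ b′ k a b →
                IsM k a b m → IsM k′ a′ b′ m
IsM-transport forth back ((I , size≡m) , minimal) with forth I
... | J , J≤I =
  (J , ≤-antisym (subst (size J ≤_) size≡m J≤I) (≤-trans (minimal (proj₁ (back J))) (proj₂ (back J)))) ,
  λ J′ → ≤-trans (minimal (proj₁ (back J′))) (proj₂ (back J′))

extend-instance : ∀ {k b} → Reduces k T b (suc k) F b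
extend-instance record { n = zero ; nonempty = () }
extend-instance record { n = suc n ; φ = φ ; uniform = uniform ; last = last ; fwins = win } =
  record
    { n = suc (suc n)
    ; nonempty = s≤s z≤n
    ; φ = extend φ
    ; uniform = extend-uniform uniform
    ; last = last
    ; fwins = moveF (λ full → full zero refl) zero refl false
                    (FWins-insert extend-sat (Inserts-empty zero false) win)
    } ,
  ≤-reflexive (length-map _ φ)
  where open Extend zero false

emptyClause-instance : Instance 0 T F
emptyClause-instance = record
  { n = 2
  ; nonempty = s≤s z≤n
  ; φ = [] ∷ []
  ; uniform = (refl , []) ∷ []
  ; last = refl
  ; fwins = moveT (λ full → full zero refl) reply
  }
  where
  unsat : ∀ {σ} → ¬ Sat σ ([] ∷ [])
  unsat (() ∷ [])
  reply : ∀ v → empty v ≡ nothing → ∀ b → FWins ([] ∷ []) F (empty [ v ≔ b ])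
  reply zero _ b =
    moveF (λ full → full (suc zero) refl) (suc zero) refl false (end (λ { zero () ; (suc zero) () }) unsat)
  reply (suc zero) _ b =
    moveF (λ full → full zero refl) zero refl false (end (λ { zero () ; (suc zero) () }) unsat)

noVariables-unsat : ∀ {k σ} (φ : CNF 0) → Uniform k φ → ¬ Sat σ φ → k ≡ 0 × 1 ≤ length φ
noVariables-unsat [] [] unsat = ⊥-elim (unsat [])
noVariables-unsat ([] ∷ φ) ((len , _) ∷ _) _ = sym len , s≤s z≤n
noVariables-unsat (((() , _) ∷ _) ∷ _) _ _

-- With no variable left, F's win means φ contains the empty clause, forcing k = 0;
-- the two-variable instance with a single empty clause then has the right mover parity.
winning-instance : ∀ {k b} n → lastMover F (suc n) ≡ b → (φ : CNF n) → Uniform k φ →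
                   FWins φ T empty → Σ (Instance k T b) λ I → size I ≤ length φ
winning-instance zero refl φ uniform (end _ unsat) with noVariables-unsat φ uniform unsat
... | refl , nonempty = emptyClause-instance , nonempty
winning-instance zero _ φ _ (moveT notFull _) = ⊥-elim (notFull λ ())
winning-instance (suc n) last φ uniform win =
  record { n = suc n ; nonempty = s≤s z≤n ; φ = φ ; uniform = uniform ; last = last ; fwins = win } ,
  ≤-refl

restrict-instance : ∀ {k b} → Reduces (suc k) F b k T b
restrict-instance record { n = zero ; nonempty = () }
restrict-instance record { n = suc n ; fwins = end full _ } = ⊥-elim (full zero refl)
restrict-instance {k} record { n = suc n ; φ = ψ ; uniform = uniform ; last = last ; fwins = moveF _ i _ c win } =
  map₂ (λ I≤ → ≤-trans I≤ (length-restrict ψ))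
       (winning-instance n last (restrict ψ) (restrict-uniform uniform)
                         (FWins-delete restrict-sat (Inserts-empty i c) win))
  where open Restrict i c k

mainTheorem3 : ∀ (k : ℕ) (b : Player) (m : ℕ) →
    IsM (suc k) F b m ⇔ IsM k T b m
mainTheorem3 k b m =
  mk⇔ (IsM-transport restrict-instance extend-instance)
      (IsM-transport extend-instance restrict-instance)
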